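{- Let $|\Delta|$, $A_{BR}$, $A_{BB}$, $A_B$, $A_R$ be as defined in the context. Then $$|\Delta|\le \tfrac23|A_{BR}|+\tfrac43|A_{BB}|+|A_B|+\tfrac13|A_R|.$$
   Context: Let $G=(A,I,E)$ be a bipartite graph (advertisers $A$, impressions $I$). Build the boosted flow network: source $s$, edges $(s,a)$ of capacity $2$ for $a\in A$, edges of $E$ directed $A\to I$ with capacity $1$, edges $(i,t)$ of capacity $2$ to a sink $t$ for $i\in I$. Fix an integral maximum $s$-$t$ flow and let $F\subseteq E$ be the edges carrying (unit) flow; the graph induced by $F$ is a disjoint union of paths and cycles. Color the edges of $F$: cycle edges alternately blue and red; odd-length paths alternately blue and red with more blue than red; even-length paths whose endpoints are both in $A$ alternately blue and red; even-length paths whose endpoints are both in $I$: first two edges blue, then alternately red, blue, red, ..., ending in blue. Let $A_{BR}$ be the advertisers incident to one blue and one red edge, $A_{BB}$ those incident to two blue edges, $A_B$ those incident to exactly one edge, which is blue, and $A_R$ those incident to exactly one edge, which is red. Let $(S,T)$ be the $s$-$t$ cut obtained as follows: start with $S$ = set of nodes reachable from $s$ in the residual graph of the flow, $T$ its complement; then, for every $i\in I\cap T$ that is adjacent (via $E$) to more than one advertiser in $A\cap S$, move $i$ to $S$. Let $A_S=A\cap S$, $I_T=I\cap T$, and let $\Delta$ be the set of edges $(a,i)\in E$ with $a\in A_S$ and $i\in I_T$. -}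

module Defs where

open import Data.Nat using (ℕ; zero; suc; _+_; _*_; _≤_; _<_; _≥_; _≡ᵇ_; _≤ᵇ_)
open import Data.Bool using (Bool; true; false; if_then_else_; _∧_; _∨_; not)
open import Data.Fin using (Fin; zero; suc; inject₁; fromℕ; toℕ)
open import Data.Sum using (_⊎_; inj₁; inj₂)
open import Data.Product using (_×_; Σ; ∃; ∃-syntax)
open import Data.Empty using (⊥)
open import Relation.Binary.PropositionalEquality using (_≡_)
open import Function.Definitions using (Injective)

count : ∀ {n} → (Fin n → Bool) → ℕ
count {zero}  p = 0
count {suc n} p = (if p zero then 1 else 0) + count (λ k → p (suc k))

sumFin : ∀ {n} → (Fin n → ℕ) → ℕ
sumFin {zero}  g = 0
sumFin {suc n} g = g zero + sumFin (λ k → g (suc k))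

isEven : ℕ → Bool
isEven zero          = true
isEven (suc zero)    = false
isEven (suc (suc n)) = isEven n

-- Bipartite graph G = (A, I, E) with A = Fin na, I = Fin ni,
-- E a i ≡ true  iff  (a , i) ∈ E.
-- An integral s-t flow of the boosted network is determined by the
-- set F ⊆ E of unit-flow middle edges (f a i ≡ true iff (a,i) ∈ F);
-- the flow on (s,a) is degA f a and on (i,t) is degI f i.

module _ {na ni : ℕ} (f : Fin na → Fin ni → Bool) where

  degA : Fin na → ℕ
  degA a = count (λ i → f a i)

  degI : Fin ni → ℕ
  degI i = count (λ a → f a i)

  flowValue : ℕ
  flowValue = sumFin degA

module _ {na ni : ℕ} (E : Fin na → Fin ni → Bool) where

  -- feasibility: F ⊆ E, capacity 2 on (s,a) and on (i,t)
  -- (capacity 1 on middle edges is built into the Bool encoding)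
  IsFlow : (Fin na → Fin ni → Bool) → Set
  IsFlow f = (∀ a i → f a i ≡ true → E a i ≡ true)
           × (∀ a → degA f a ≤ 2)
           × (∀ i → degI f i ≤ 2)

  IsMaxFlow : (Fin na → Fin ni → Bool) → Set
  IsMaxFlow f = IsFlow f × (∀ g → IsFlow g → flowValue g ≤ flowValue f)

data Node (na ni : ℕ) : Set where
  src : Node na ni
  snk : Node na ni
  adv : Fin na → Node na ni
  imp : Fin ni → Node na ni

module _ {na ni : ℕ} (E f : Fin na → Fin ni → Bool) where

  data ResEdge : Node na ni → Node na ni → Set where
    s→a : ∀ a → degA f a < 2 → ResEdge src (adv a)
    a→s : ∀ a → 0 < degA f a → ResEdge (adv a) src
    a→i : ∀ a i → E a i ≡ true → f a i ≡ false → ResEdge (adv a) (imp i)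
    i→a : ∀ a i → f a i ≡ true → ResEdge (imp i) (adv a)
    i→t : ∀ i → degI f i < 2 → ResEdge (imp i) snk
    t→i : ∀ i → 0 < degI f i → ResEdge snk (imp i)

  data Reach : Node na ni → Set where
    here  : Reach src
    there : ∀ {u v} → Reach u → ResEdge u v → Reach v

Vtx : ℕ → ℕ → Set
Vtx na ni = Fin na ⊎ Fin ni

module _ {na ni : ℕ} (f : Fin na → Fin ni → Bool) where

  FEdge : Vtx na ni → Vtx na ni → Set
  FEdge (inj₁ a) (inj₂ i) = f a i ≡ true
  FEdge (inj₂ i) (inj₁ a) = f a i ≡ true
  FEdge _        _        = ⊥

  degF : Vtx na ni → ℕ
  degF (inj₁ a) = degA f a
  degF (inj₂ i) = degI f i

  record Walk : Set where
    field
      len  : ℕ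
      vert : Fin (suc len) → Vtx na ni
      step : (j : Fin len) → FEdge (vert (inject₁ j)) (vert (suc j))

  open Walk public

  -- a whole path component: ≥ 1 edge, distinct vertices,
  -- both endpoints of F-degree 1 (so the path is maximal)
  IsPathComp : Walk → Set
  IsPathComp w = (len w ≥ 1) × Injective _≡_ _≡_ (vert w)
               × (degF (vert w zero) ≡ 1) × (degF (vert w (fromℕ (len w))) ≡ 1)

  IsCycleComp : Walk → Set
  IsCycleComp w = (len w ≥ 3) × (vert w zero ≡ vert w (fromℕ (len w)))
                × (∀ (x y : Fin (len w)) → vert w (inject₁ x) ≡ vert w (inject₁ y) → x ≡ y)

  data Kind : Set where
    path cycle : Kind

  IsComp : Kind → Walk → Set
  IsComp path  w = IsPathComp w
  IsComp cycle w = IsCycleComp w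

  EdgeAt : (w : Walk) → Fin (len w) → Fin na → Fin ni → Set
  EdgeAt w j a i = (vert w (inject₁ j) ≡ inj₁ a × vert w (suc j) ≡ inj₂ i)
                 ⊎ (vert w (inject₁ j) ≡ inj₂ i × vert w (suc j) ≡ inj₁ a)

  record Decomposition : Set where
    field
      m      : ℕ
      comp   : Fin m → Walk
      kind   : Fin m → Kind
      valid  : ∀ p → IsComp (kind p) (comp p)
      cover  : ∀ a i → f a i ≡ true → ∃[ p ] ∃[ j ] EdgeAt (comp p) j a i
      unique : ∀ a i p q (j : Fin (len (comp p))) (j' : Fin (len (comp q)))
               → EdgeAt (comp p) j a i → EdgeAt (comp q) j' a i → p ≡ q

  open Decomposition public

  startsInA : Vtx na ni → Bool
  startsInA (inj₁ _) = true
  startsInA (inj₂ _) = false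

  -- colour rule (true = blue, false = red) for the j-th edge (0-based)
  -- of a component with k edges starting at vertex v₀
  --   cycle                        : blue, red, blue, red, …
  --   odd path                     : blue, red, …, blue   (more blue)
  --   even path, endpoints in A    : blue, red, …, red
  --   even path, endpoints in I    : blue, blue, red, blue, …, red, blue
  ruleBlue : Kind → (k : ℕ) → Vtx na ni → ℕ → Bool
  ruleBlue cycle k v₀ j = isEven j
  ruleBlue path  k v₀ j =
    if not (isEven k) then isEven j
    else if startsInA v₀ then isEven j
    else ((j ≡ᵇ 0) ∨ not (isEven j))

  IsColouring : Decomposition → (Fin na → Fin ni → Bool) → Set
  IsColouring D blue =
    ∀ p (j : Fin (len (comp D p))) a i → EdgeAt (comp D p) j a i →
      blue a i ≡ ruleBlue (kind D p) (len (comp D p)) (vert (comp D p) zero) (toℕ j)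

  nBlue nRed : (Fin na → Fin ni → Bool) → Fin na → ℕ
  nBlue blue a = count (λ i → f a i ∧ blue a i)
  nRed  blue a = count (λ i → f a i ∧ not (blue a i))

  cardABR cardABB cardAB cardAR : (Fin na → Fin ni → Bool) → ℕ
  cardABR blue = count (λ a → (nBlue blue a ≡ᵇ 1) ∧ (nRed blue a ≡ᵇ 1))
  cardABB blue = count (λ a → (nBlue blue a ≡ᵇ 2) ∧ (nRed blue a ≡ᵇ 0))
  cardAB  blue = count (λ a → (nBlue blue a ≡ᵇ 1) ∧ (nRed blue a ≡ᵇ 0))
  cardAR  blue = count (λ a → (nBlue blue a ≡ᵇ 0) ∧ (nRed blue a ≡ᵇ 1))

-- The cut (S,T) and Δ.  inS is the (decidable) characteristic function
-- of the residual-reachable set; the modified cut moves every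
-- i ∈ I ∩ T with > 1 neighbour in A ∩ S into S.

module _ {na ni : ℕ} (E : Fin na → Fin ni → Bool) (inS : Node na ni → Bool) where

  inAS : Fin na → Bool
  inAS a = inS (adv a)

  inIT : Fin ni → Bool
  inIT i = not (inS (imp i)) ∧ (count (λ a → E a i ∧ inAS a) ≤ᵇ 1)

  cardΔ : ℕ
  cardΔ = sumFin (λ a → count (λ i → E a i ∧ inAS a ∧ inIT i))

module Submission where

-- Write δ(a), δ(i) for the number of Δ-edges at an advertiser a
-- or an impression i, so that 3|Δ| = Σ_a δ(a) + 2 Σ_i δ(i).  Let σ count the
-- flow edges whose impression lies in S (seen from either end) and β(x) the
-- blue edges at x.
--   (1) Advertisers: δ(a) ≤ [deg a = 1] + σ(a).  A Δ-edge out of a reachable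
--       advertiser must carry flow (otherwise its impression is reachable), and
--       a saturated reachable advertiser is reached backwards along a flow edge
--       from a reachable impression.
--   (2) Impressions: σ(i) + 2δ(i) ≤ 2β(i).  The left side is at most 2 (an
--       impression in S meets no Δ-edge; one in T meets at most one, by the
--       modification of the cut), it vanishes if i carries no flow, and every
--       impression carrying flow has a blue edge (a property of the colouring).
--   (3) Double counting turns Σ_a σ(a) into Σ_i σ(i) and Σ_i β(i) into Σ_a β(a),
--       so 3|Δ| ≤ Σ_a ([deg a = 1] + 2β(a)), and a case check on the colour
--       profile of each advertiser bounds the summand by its weight 2,4,3,1.

open import Defs
open import Data.Nat using (ℕ; zero; suc; _+_; _*_; _≤_; _<_; z≤n; s≤s; _≡ᵇ_; _≟_)
open import Data.Nat.Properties
open import Algebra.Properties.CommutativeSemigroup +-commutativeSemigroup using (interchange)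
open import Data.Bool using (Bool; true; false; if_then_else_; _∧_; _∨_; not; T)
open import Data.Bool.Properties using (∨-zeroʳ; not-involutive; not-¬)
open import Data.Fin using (Fin; zero; suc; inject₁; fromℕ; toℕ; lower₁)
open import Data.Fin.Properties using (toℕ-inject₁; toℕ-lower₁; inject₁-lower₁; toℕ-fromℕ; toℕ-injective)
open import Data.Sum using (_⊎_; inj₁; inj₂)
open import Data.Product using (Σ; _,_; _×_; proj₁; proj₂)
open import Data.Empty using (⊥; ⊥-elim)
open import Relation.Nullary using (yes; no)
open import Relation.Binary.PropositionalEquality

ind : Bool → ℕ
ind b = if b then 1 else 0

true≢false : true ≡ false → ⊥
true≢false ()

∧-true : ∀ {x y} → x ∧ y ≡ true → (x ≡ true) × (y ≡ true)
∧-true {true} {true} _ = refl , refl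

∧-intro : ∀ {x y} → x ≡ true → y ≡ true → x ∧ y ≡ true
∧-intro refl refl = refl

not-true : ∀ {b} → not b ≡ true → b ≡ false
not-true {false} _ = refl

boolCases : ∀ b → (b ≡ true) ⊎ (b ≡ false)
boolCases true  = inj₁ refl
boolCases false = inj₂ refl

count-mono : ∀ {n} {p q : Fin n → Bool} → (∀ k → p k ≡ true → q k ≡ true) → count p ≤ count q
count-mono {zero} h = z≤n
count-mono {suc n} {p} {q} h with p zero in e₁ | q zero in e₂
... | true  | true  = s≤s (count-mono (λ k → h (suc k)))
... | true  | false = ⊥-elim (true≢false (trans (sym (h zero e₁)) e₂))
... | false | true  = m≤n⇒m≤1+n (count-mono (λ k → h (suc k)))
... | false | false = count-mono (λ k → h (suc k))

count-none : ∀ {n} {p : Fin n → Bool} → (∀ k → p k ≡ true → ⊥) → count p ≡ 0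
count-none {zero} h = refl
count-none {suc n} {p} h with p zero in e
... | true  = ⊥-elim (h zero e)
... | false = count-none (λ k → h (suc k))

count-split : ∀ {n} (p q : Fin n → Bool) →
  count (λ k → p k ∧ q k) + count (λ k → p k ∧ not (q k)) ≡ count p
count-split {zero} p q = refl
count-split {suc n} p q with p zero | q zero
... | true  | true  = cong suc (count-split (λ k → p (suc k)) (λ k → q (suc k)))
... | true  | false = trans (+-suc _ _) (cong suc (count-split (λ k → p (suc k)) (λ k → q (suc k))))
... | false | _     = count-split (λ k → p (suc k)) (λ k → q (suc k))

count-pos : ∀ {n} (p : Fin n → Bool) k → p k ≡ true → 1 ≤ count p
count-pos p zero e rewrite e = s≤s z≤n
count-pos p (suc k) e with p zero
... | true  = s≤s z≤n
... | false = count-pos (λ k → p (suc k)) k e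

count-witness : ∀ {n} (p : Fin n → Bool) → 1 ≤ count p → Σ (Fin n) λ k → p k ≡ true
count-witness {suc n} p h with p zero in e
... | true  = zero , e
... | false with count-witness (λ k → p (suc k)) h
...   | k , ek = suc k , ek

count-as-sum : ∀ {n} (p : Fin n → Bool) → count p ≡ sumFin (λ k → ind (p k))
count-as-sum {zero} p = refl
count-as-sum {suc n} p = cong (ind (p zero) +_) (count-as-sum (λ k → p (suc k)))

sumFin-ext : ∀ {n} {g h : Fin n → ℕ} → (∀ k → g k ≡ h k) → sumFin g ≡ sumFin h
sumFin-ext {zero} H = refl
sumFin-ext {suc n} H = cong₂ _+_ (H zero) (sumFin-ext (λ k → H (suc k)))

sumFin-mono : ∀ {n} {g h : Fin n → ℕ} → (∀ k → g k ≤ h k) → sumFin g ≤ sumFin h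
sumFin-mono {zero} H = z≤n
sumFin-mono {suc n} H = +-mono-≤ (H zero) (sumFin-mono (λ k → H (suc k)))

sumFin-+ : ∀ {n} (g h : Fin n → ℕ) → sumFin (λ k → g k + h k) ≡ sumFin g + sumFin h
sumFin-+ {zero} g h = refl
sumFin-+ {suc n} g h =
  trans (cong (g zero + h zero +_) (sumFin-+ (λ k → g (suc k)) (λ k → h (suc k))))
        (interchange (g zero) (h zero) _ _)

sumFin-* : ∀ {n} c (g : Fin n → ℕ) → sumFin (λ k → c * g k) ≡ c * sumFin g
sumFin-* {zero} c g = sym (*-zeroʳ c)
sumFin-* {suc n} c g =
  trans (cong (c * g zero +_) (sumFin-* c (λ k → g (suc k)))) (sym (*-distribˡ-+ c (g zero) _))

sumFin-zero : ∀ {n} → sumFin {n} (λ _ → 0) ≡ 0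
sumFin-zero {zero} = refl
sumFin-zero {suc n} = sumFin-zero {n}

sumFin-swap : ∀ {m n} (g : Fin m → Fin n → ℕ) →
  sumFin (λ a → sumFin (λ i → g a i)) ≡ sumFin (λ i → sumFin (λ a → g a i))
sumFin-swap {zero} {n} g = sym (sumFin-zero {n})
sumFin-swap {suc m} g =
  trans (cong (sumFin (g zero) +_) (sumFin-swap (λ a → g (suc a))))
        (sym (sumFin-+ (g zero) (λ i → sumFin (λ a → g (suc a) i))))

count-swap : ∀ {m n} (P : Fin m → Fin n → Bool) →
  sumFin (λ a → count (λ i → P a i)) ≡ sumFin (λ i → count (λ a → P a i))
count-swap P = begin
  sumFin (λ a → count (P a))                          ≡⟨ sumFin-ext (λ a → count-as-sum (P a)) ⟩
  sumFin (λ a → sumFin (λ i → ind (P a i)))           ≡⟨ sumFin-swap (λ a i → ind (P a i)) ⟩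
  sumFin (λ i → sumFin (λ a → ind (P a i)))           ≡⟨ sumFin-ext (λ i → sym (count-as-sum (λ a → P a i))) ⟩
  sumFin (λ i → count (λ a → P a i))                  ∎
  where open ≡-Reasoning

sumFin-scaledInd : ∀ {n} c (p : Fin n → Bool) → sumFin (λ k → c * ind (p k)) ≡ c * count p
sumFin-scaledInd c p = trans (sumFin-* c (λ k → ind (p k))) (cong (c *_) (sym (count-as-sum p)))

isEven-suc : ∀ n → isEven (suc n) ≡ not (isEven n)
isEven-suc zero = refl
isEven-suc (suc zero) = refl
isEven-suc (suc (suc n)) = isEven-suc n

module Colouring {na ni : ℕ} (f : Fin na → Fin ni → Bool) where

  side-flips : ∀ u w → FEdge f u w → startsInA f w ≡ not (startsInA f u)
  side-flips (inj₁ a) (inj₂ i) _ = refl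
  side-flips (inj₂ i) (inj₁ a) _ = refl

  advertiserBefore : ∀ {i} x y → y ≡ inj₂ i → FEdge f x y → Σ (Fin na) λ a → x ≡ inj₁ a
  advertiserBefore (inj₁ a) _ refl _ = a , refl

  advertiserAfter : ∀ {i} x y → x ≡ inj₂ i → FEdge f x y → Σ (Fin na) λ a → y ≡ inj₁ a
  advertiserAfter _ (inj₁ a) refl _ = a , refl

  kindCases : (κ : Kind f) → (κ ≡ cycle) ⊎ (κ ≡ path)
  kindCases cycle = inj₁ refl
  kindCases path  = inj₂ refl

  firstEdgeBlue : ∀ κ k v → ruleBlue f κ k v 0 ≡ true
  firstEdgeBlue cycle k v = refl
  firstEdgeBlue path k v with isEven k | startsInA f v
  ... | false | _     = refl
  ... | true  | true  = refl
  ... | true  | false = refl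

  redParity : ∀ κ k v → Σ Bool λ b → ∀ n → ruleBlue f κ k v n ≡ false → isEven n ≡ b
  redParity cycle k v = false , λ n red → red
  redParity path k v with isEven k | startsInA f v
  ... | false | _     = false , λ n red → red
  ... | true  | true  = false , λ n red → red
  ... | true  | false = true , evenIfRed
    where
    evenIfRed : ∀ n → (n ≡ᵇ 0) ∨ not (isEven n) ≡ false → isEven n ≡ true
    evenIfRed n red with isEven n
    ... | true  = refl
    ... | false = ⊥-elim (true≢false (trans (sym (∨-zeroʳ (n ≡ᵇ 0))) red))

  noTwoReds : ∀ κ k v n → ruleBlue f κ k v n ≡ false → ruleBlue f κ k v (suc n) ≡ false → ⊥
  noTwoReds κ k v n red red′ with redParity κ k v
  ... | b , par = not-¬ refl (trans (sym (par (suc n) red′)) (trans (isEven-suc n) (cong not (par n red))))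

  blueBeforeRed : ∀ κ k v n → ruleBlue f κ k v (suc n) ≡ false → ruleBlue f κ k v n ≡ true
  blueBeforeRed κ k v n red′ with ruleBlue f κ k v n in e
  ... | true  = refl
  ... | false = ⊥-elim (noTwoReds κ k v n e red′)

  blueAfterRed : ∀ κ k v n → ruleBlue f κ k v n ≡ false → ruleBlue f κ k v (suc n) ≡ true
  blueAfterRed κ k v n red with ruleBlue f κ k v (suc n) in e
  ... | true  = refl
  ... | false = ⊥-elim (noTwoReds κ k v n red e)

  redLastPathEdge : ∀ n v → ruleBlue f path (suc n) v n ≡ false →
    (isEven (suc n) ≡ true) × (startsInA f v ≡ true)
  redLastPathEdge n v red rewrite isEven-suc n with isEven n | startsInA f v
  ... | true  | _     = ⊥-elim (true≢false red)
  ... | false | true  = refl , refl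
  ... | false | false = ⊥-elim (true≢false (trans (sym (∨-zeroʳ (n ≡ᵇ 0))) red))

  module _ (L : ℕ) (v : Fin (suc L) → Vtx na ni)
           (st : ∀ j → FEdge f (v (inject₁ j)) (v (suc j)))
           (κ : Kind f) (closed : κ ≡ cycle → v zero ≡ v (fromℕ L)) where

    W : Walk f
    W = record { len = L ; vert = v ; step = st }

    colour : ℕ → Bool
    colour = ruleBlue f κ L (v zero)

    BlueEdgeAt : Fin ni → Set
    BlueEdgeAt i = Σ (Fin L) λ j → Σ (Fin na) λ a → EdgeAt f W j a i × (colour (toℕ j) ≡ true)

    sideParity : ∀ n (x : Fin (suc L)) → toℕ x ≡ n →
      startsInA f (v x) ≡ (if isEven n then startsInA f (v zero) else not (startsInA f (v zero)))
    sideParity zero zero refl = refl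
    sideParity (suc n) (suc y) eq rewrite isEven-suc n
      with isEven n | sideParity n (inject₁ y) (trans (toℕ-inject₁ y) (suc-injective eq))
    ... | true  | ih = trans (side-flips _ _ (st y)) (cong not ih)
    ... | false | ih = trans (side-flips _ _ (st y)) (trans (cong not ih) (not-involutive _))

    blueLeaving : ∀ j i → v (inject₁ j) ≡ inj₂ i → colour (toℕ j) ≡ true → BlueEdgeAt i
    blueLeaving j i vi blue with advertiserAfter _ _ vi (st j)
    ... | a , va = j , a , inj₂ (vi , va) , blue

    blueEntering : ∀ j i → v (suc j) ≡ inj₂ i → colour (toℕ j) ≡ true → BlueEdgeAt i
    blueEntering j i vi blue with advertiserBefore _ _ vi (st j)
    ... | a , va = j , a , inj₁ (va , vi) , blue

    blueBeforeLeaving : ∀ j i → v (inject₁ j) ≡ inj₂ i → colour (toℕ j) ≡ false → BlueEdgeAt i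
    blueBeforeLeaving zero i _ red = ⊥-elim (true≢false (trans (sym (firstEdgeBlue κ L (v zero))) red))
    blueBeforeLeaving (suc j) i vi red = blueEntering (inject₁ j) i vi
      (subst (λ n → colour n ≡ true) (sym (toℕ-inject₁ j)) (blueBeforeRed κ L (v zero) (toℕ j) red))

    blueAfterEntering : ∀ j i (notLast : L ≢ suc (toℕ j)) → v (suc j) ≡ inj₂ i →
      colour (toℕ j) ≡ false → BlueEdgeAt i
    blueAfterEntering j i notLast vi red = blueLeaving (lower₁ (suc j) notLast) i
      (trans (cong v (inject₁-lower₁ (suc j) notLast)) vi)
      (subst (λ n → colour n ≡ true) (sym (toℕ-lower₁ (suc j) notLast)) (blueAfterRed κ L (v zero) (toℕ j) red))

    blueFirstEdge : Fin L → ∀ i → v zero ≡ inj₂ i → BlueEdgeAt i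
    blueFirstEdge zero    i vi = blueLeaving zero i vi (firstEdgeBlue κ (suc _) (v zero))
    blueFirstEdge (suc _) i vi = blueLeaving zero i vi (firstEdgeBlue κ (suc _) (v zero))

    lastVertex : ∀ j i → L ≡ suc (toℕ j) → v (suc j) ≡ inj₂ i → v (fromℕ L) ≡ inj₂ i
    lastVertex j i isLast vi = trans (cong v (toℕ-injective (trans (toℕ-fromℕ L) isLast))) vi

    -- A red last edge entering i: for a cycle it is followed by the first
    -- edge, which is blue; a path cannot end this way, since it would have
    -- even length and start in A, hence also end in A.
    blueAtClosingEnd : ∀ j i (isLast : L ≡ suc (toℕ j)) → v (suc j) ≡ inj₂ i →
      colour (toℕ j) ≡ false → BlueEdgeAt i
    blueAtClosingEnd j i isLast vi red with kindCases κ
    ... | inj₁ isCycle = blueFirstEdge j i (trans (closed isCycle) vL)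
      where
      vL : v (fromℕ L) ≡ inj₂ i
      vL = lastVertex j i isLast vi
    ... | inj₂ isPath with redLastPathEdge (toℕ j) (v zero)
          (subst₂ (λ κ′ K → ruleBlue f κ′ K (v zero) (toℕ j) ≡ false) isPath isLast red)
    ...   | even , startA = ⊥-elim (true≢false (trans (sym endInA) (cong (startsInA f) vL)))
      where
      vL : v (fromℕ L) ≡ inj₂ i
      vL = lastVertex j i isLast vi
      endInA : startsInA f (v (fromℕ L)) ≡ true
      endInA = trans (sideParity (suc (toℕ j)) (fromℕ L) (trans (toℕ-fromℕ L) isLast))
        (trans (cong (λ b → if b then startsInA f (v zero) else not (startsInA f (v zero))) even) startA)

    blueEdgeAt : ∀ j a i → EdgeAt f W j a i → BlueEdgeAt i
    blueEdgeAt j a i e with colour (toℕ j) in c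
    ... | true = j , a , e , c
    blueEdgeAt j a i (inj₂ (vi , _)) | false = blueBeforeLeaving j i vi c
    blueEdgeAt j a i (inj₁ (_ , vi)) | false with L ≟ suc (toℕ j)
    ... | no notLast = blueAfterEntering j i notLast vi c
    ... | yes isLast = blueAtClosingEnd j i isLast vi c

  edgeInF : (w : Walk f) → ∀ j a i → EdgeAt f w j a i → f a i ≡ true
  edgeInF w j a i (inj₁ (p , q)) = subst₂ (FEdge f) p q (step w j)
  edgeInF w j a i (inj₂ (p , q)) = subst₂ (FEdge f) p q (step w j)

  closedIfCycle : ∀ κ (w : Walk f) → IsComp f κ w → κ ≡ cycle → vert w zero ≡ vert w (fromℕ (len w))
  closedIfCycle cycle w (_ , closed , _) refl = closed

  coveredImpressionHasBlue : (D : Decomposition f) (blue : Fin na → Fin ni → Bool) →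
    IsColouring f D blue → ∀ i → 1 ≤ degI f i → 1 ≤ count (λ a → f a i ∧ blue a i)
  coveredImpressionHasBlue D blue col i covered with count-witness (λ a → f a i) covered
  ... | a , fai with cover D a i fai
  ... | p , j , e with blueEdgeAt (len (comp D p)) (vert (comp D p)) (step (comp D p)) (kind D p)
                         (closedIfCycle (kind D p) (comp D p) (valid D p)) j a i e
  ... | j′ , a′ , e′ , isBlue = count-pos (λ a → f a i ∧ blue a i) a′ blueInF
    where
    blueInF : f a′ i ∧ blue a′ i ≡ true
    blueInF = ∧-intro (edgeInF (comp D p) j′ a′ i e′) (trans (col p j′ a′ i e′) isBlue)

-- An advertiser with v flow edges into S and u into T (capacity 2, and v ≥ 1
-- when saturated) has u ≤ [u + v = 1] + v.
outflowBound : ∀ u v → v + u ≤ 2 → (v + u ≡ 2 → 1 ≤ v) → u ≤ ind ((v + u) ≡ᵇ 1) + v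
outflowBound zero v _ _ = z≤n
outflowBound (suc zero) zero _ _ = s≤s z≤n
outflowBound (suc zero) (suc zero) _ _ = s≤s z≤n
outflowBound (suc (suc zero)) zero _ saturated with saturated refl
... | ()
outflowBound (suc (suc (suc u))) zero (s≤s (s≤s ()))
outflowBound (suc (suc u)) (suc zero) (s≤s (s≤s ()))
outflowBound (suc u) (suc (suc v)) (s≤s (s≤s le)) with m+n≤o⇒n≤o v le
... | ()

-- The weight of an advertiser with b blue and r red edges: 2 for A_BR,
-- 4 for A_BB, 3 for A_B, 1 for A_R (three times the coefficients).
classWeight : ℕ → ℕ → ℕ
classWeight b r = 2 * ind ((b ≡ᵇ 1) ∧ (r ≡ᵇ 1)) + 4 * ind ((b ≡ᵇ 2) ∧ (r ≡ᵇ 0))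
                + 3 * ind ((b ≡ᵇ 1) ∧ (r ≡ᵇ 0)) + ind ((b ≡ᵇ 0) ∧ (r ≡ᵇ 1))

sumClassWeight : ∀ {n} (b r : Fin n → ℕ) → sumFin (λ a → classWeight (b a) (r a))
  ≡ 2 * count (λ a → (b a ≡ᵇ 1) ∧ (r a ≡ᵇ 1)) + 4 * count (λ a → (b a ≡ᵇ 2) ∧ (r a ≡ᵇ 0))
  + 3 * count (λ a → (b a ≡ᵇ 1) ∧ (r a ≡ᵇ 0)) + count (λ a → (b a ≡ᵇ 0) ∧ (r a ≡ᵇ 1))
sumClassWeight b r = begin
  sumFin (λ a → w₁ a + w₂ a + w₃ a + w₄ a)
    ≡⟨ sumFin-+ (λ a → w₁ a + w₂ a + w₃ a) w₄ ⟩
  sumFin (λ a → w₁ a + w₂ a + w₃ a) + sumFin w₄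
    ≡⟨ cong (_+ sumFin w₄) (sumFin-+ (λ a → w₁ a + w₂ a) w₃) ⟩
  sumFin (λ a → w₁ a + w₂ a) + sumFin w₃ + sumFin w₄
    ≡⟨ cong (λ x → x + sumFin w₃ + sumFin w₄) (sumFin-+ w₁ w₂) ⟩
  sumFin w₁ + sumFin w₂ + sumFin w₃ + sumFin w₄
    ≡⟨ cong₂ _+_ (cong₂ _+_ (cong₂ _+_ (sumFin-scaledInd 2 BR) (sumFin-scaledInd 4 BB))
                            (sumFin-scaledInd 3 B₁))
                 (sym (count-as-sum R₁)) ⟩
  2 * count BR + 4 * count BB + 3 * count B₁ + count R₁ ∎
  where
  open ≡-Reasoning
  BR BB B₁ R₁ : _ → Bool
  BR a = (b a ≡ᵇ 1) ∧ (r a ≡ᵇ 1)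
  BB a = (b a ≡ᵇ 2) ∧ (r a ≡ᵇ 0)
  B₁ a = (b a ≡ᵇ 1) ∧ (r a ≡ᵇ 0)
  R₁ a = (b a ≡ᵇ 0) ∧ (r a ≡ᵇ 1)
  w₁ w₂ w₃ w₄ : _ → ℕ
  w₁ a = 2 * ind (BR a)
  w₂ a = 4 * ind (BB a)
  w₃ a = 3 * ind (B₁ a)
  w₄ a = ind (R₁ a)

-- Step (3) at one advertiser: a single edge or a blue edge is paid by the weight.
weightBound : ∀ b r → b + r ≤ 2 → ind ((b + r) ≡ᵇ 1) + 2 * b ≤ classWeight b r
weightBound 0 0 _ = z≤n
weightBound 0 1 _ = s≤s z≤n
weightBound 0 2 _ = z≤n
weightBound 1 0 _ = ≤-refl
weightBound 1 1 _ = ≤-refl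
weightBound 2 0 _ = ≤-refl
weightBound 0 (suc (suc (suc r))) (s≤s (s≤s ()))
weightBound 1 (suc (suc r)) (s≤s (s≤s ()))
weightBound 2 (suc r) (s≤s (s≤s ()))
weightBound (suc (suc (suc b))) r (s≤s (s≤s ()))

presenceBound : ∀ {x y d b} → x + 2 * y ≤ 2 → x ≤ d → y ≤ d → (1 ≤ d → 1 ≤ b) → x + 2 * y ≤ 2 * b
presenceBound {d = zero}  _    z≤n z≤n _       = z≤n
presenceBound {d = suc d} load _   _   present = ≤-trans load (*-monoʳ-≤ 2 (present (s≤s z≤n)))

module Cut {na ni : ℕ} (E f : Fin na → Fin ni → Bool) (feasible : IsFlow E f)
    (inS : Node na ni → Bool)
    (sound : ∀ v → Reach E f v → inS v ≡ true)
    (complete : ∀ v → inS v ≡ true → Reach E f v) where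

  InΔ : Fin na → Fin ni → Bool
  InΔ a i = E a i ∧ inAS E inS a ∧ inIT E inS i

  advertiserInS : ∀ {a i} → InΔ a i ≡ true → inS (adv a) ≡ true
  advertiserInS {a} {i} h = proj₁ (∧-true {inS (adv a)} (proj₂ (∧-true {E a i} h)))

  impressionInT : ∀ {a i} → InΔ a i ≡ true → inIT E inS i ≡ true
  impressionInT {a} {i} h = proj₂ (∧-true {inS (adv a)} (proj₂ (∧-true {E a i} h)))

  -- A Δ-edge carries flow and ends outside S: a flow-free edge of E would be
  -- a residual edge from a reachable advertiser.
  ΔEdgeIsOutgoingFlow : ∀ a i → InΔ a i ≡ true → f a i ∧ not (inS (imp i)) ≡ true
  ΔEdgeIsOutgoingFlow a i h with f a i in fai
  ... | true  = proj₁ (∧-true (impressionInT h))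
  ... | false = ⊥-elim (true≢false (trans (sym reached) iNotInS))
    where
    reached : inS (imp i) ≡ true
    reached = sound (imp i) (there (complete (adv a) (advertiserInS h)) (a→i a i (proj₁ (∧-true h)) fai))
    iNotInS : inS (imp i) ≡ false
    iNotInS = not-true (proj₁ (∧-true (impressionInT h)))

  intoS : Fin na → ℕ
  intoS a = count (λ i → f a i ∧ inS (imp i))

  intoSAt : Fin ni → ℕ
  intoSAt i = count (λ a → f a i ∧ inS (imp i))

  saturatedReachedThroughFlow : ∀ a → Reach E f (adv a) → degA f a ≡ 2 → 1 ≤ intoS a
  saturatedReachedThroughFlow a (there r (s→a .a unsat)) sat = ⊥-elim (<-irrefl refl (subst (_< 2) sat unsat))
  saturatedReachedThroughFlow a (there r (i→a .a i fai)) sat =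
    count-pos (λ i → f a i ∧ inS (imp i)) i (∧-intro fai (sound (imp i) r))

  ΔAtAdvertiser : ∀ a → count (InΔ a) ≤ ind (degA f a ≡ᵇ 1) + intoS a
  ΔAtAdvertiser a with boolCases (inS (adv a))
  ... | inj₂ aNotInS = ≤-trans (≤-reflexive (count-none noEdge)) z≤n
    where
    noEdge : ∀ i → InΔ a i ≡ true → ⊥
    noEdge i h = true≢false (trans (sym (advertiserInS h)) aNotInS)
  ... | inj₁ aInS = ≤-trans (count-mono (ΔEdgeIsOutgoingFlow a))
    (subst (λ d → outOfS ≤ ind (d ≡ᵇ 1) + intoS a) split
      (outflowBound outOfS (intoS a) (subst (_≤ 2) (sym split) (proj₁ (proj₂ feasible) a))
        (λ sat → saturatedReachedThroughFlow a (complete (adv a) aInS) (trans (sym split) sat))))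
    where
    outOfS : ℕ
    outOfS = count (λ i → f a i ∧ not (inS (imp i)))
    split : intoS a + outOfS ≡ degA f a
    split = count-split (f a) (λ i → inS (imp i))

  ΔAt : Fin ni → ℕ
  ΔAt i = count (λ a → InΔ a i)

  -- The modification of the cut leaves at most one Δ-edge at each impression.
  ΔAt≤1 : ∀ i → ΔAt i ≤ 1
  ΔAt≤1 i with boolCases (inIT E inS i)
  ... | inj₁ iInT = ≤-trans (count-mono {q = neighbourInS} (λ a h → ∧-intro (proj₁ (∧-true h)) (advertiserInS h)))
    (≤ᵇ⇒≤ (count neighbourInS) 1 (subst T (sym (proj₂ (∧-true iInT))) _))
    where
    neighbourInS : Fin na → Bool
    neighbourInS a = E a i ∧ inAS E inS a
  ... | inj₂ iNotInT = ≤-trans (≤-reflexive (count-none noEdge)) z≤n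
    where
    noEdge : ∀ a → InΔ a i ≡ true → ⊥
    noEdge a h = true≢false (trans (sym (impressionInT h)) iNotInT)

  ΔAt≤deg : ∀ i → ΔAt i ≤ degI f i
  ΔAt≤deg i = count-mono {q = λ a → f a i} (λ a h → proj₁ (∧-true (ΔEdgeIsOutgoingFlow a i h)))

  intoSAt≤deg : ∀ i → intoSAt i ≤ degI f i
  intoSAt≤deg i = count-mono {q = λ a → f a i} (λ a h → proj₁ (∧-true h))

  -- σ(i) + 2δ(i) ≤ 2: an impression in S meets no Δ-edge, and σ vanishes on T.
  impressionLoad : ∀ i → intoSAt i + 2 * ΔAt i ≤ 2
  impressionLoad i with boolCases (inS (imp i))
  ... | inj₁ iInS = subst (λ c → intoSAt i + 2 * c ≤ 2) (sym (count-none noEdge))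
    (subst (_≤ 2) (sym (+-identityʳ (intoSAt i))) (≤-trans (intoSAt≤deg i) (proj₂ (proj₂ feasible) i)))
    where
    noEdge : ∀ a → InΔ a i ≡ true → ⊥
    noEdge a h = true≢false (trans (sym iInS) (not-true (proj₂ (∧-true (ΔEdgeIsOutgoingFlow a i h)))))
  ... | inj₂ iNotInS = subst (λ x → x + 2 * ΔAt i ≤ 2) (sym (count-none noFlow)) (*-monoʳ-≤ 2 (ΔAt≤1 i))
    where
    noFlow : ∀ a → f a i ∧ inS (imp i) ≡ true → ⊥
    noFlow a h = true≢false (trans (sym (proj₂ (∧-true h))) iNotInS)

module DoubleCounting {na ni : ℕ} (E f : Fin na → Fin ni → Bool) (feasible : IsFlow E f)
    (D : Decomposition f) (blue : Fin na → Fin ni → Bool) (col : IsColouring f D blue)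
    (inS : Node na ni → Bool)
    (sound : ∀ v → Reach E f v → inS v ≡ true)
    (complete : ∀ v → inS v ≡ true → Reach E f v) where

  open Cut E f feasible inS sound complete
  open Colouring f using (coveredImpressionHasBlue)
  open ≤-Reasoning

  single : Fin na → ℕ
  single a = ind (degA f a ≡ᵇ 1)

  advertiserSide : cardΔ E inS ≤ sumFin single + sumFin intoSAt
  advertiserSide = begin
    cardΔ E inS                         ≤⟨ sumFin-mono ΔAtAdvertiser ⟩
    sumFin (λ a → single a + intoS a)   ≡⟨ sumFin-+ single intoS ⟩
    sumFin single + sumFin intoS        ≡⟨ cong (sumFin single +_) (count-swap (λ a i → f a i ∧ inS (imp i))) ⟩
    sumFin single + sumFin intoSAt      ∎

  impressionSide : sumFin intoSAt + 2 * cardΔ E inS ≤ 2 * sumFin (nBlue f blue)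
  impressionSide = begin
    sumFin intoSAt + 2 * cardΔ E inS       ≡⟨ cong (λ c → sumFin intoSAt + 2 * c) (count-swap InΔ) ⟩
    sumFin intoSAt + 2 * sumFin ΔAt        ≡⟨ sym (trans (sumFin-+ intoSAt (λ i → 2 * ΔAt i))
                                                         (cong (sumFin intoSAt +_) (sumFin-* 2 ΔAt))) ⟩
    sumFin (λ i → intoSAt i + 2 * ΔAt i)   ≤⟨ sumFin-mono impressionBound ⟩
    sumFin (λ i → 2 * blueAt i)            ≡⟨ sumFin-* 2 blueAt ⟩
    2 * sumFin blueAt                      ≡⟨ cong (2 *_) (sym (count-swap (λ a i → f a i ∧ blue a i))) ⟩
    2 * sumFin (nBlue f blue)              ∎
    where
    blueAt : Fin ni → ℕ
    blueAt i = count (λ a → f a i ∧ blue a i)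
    impressionBound : ∀ i → intoSAt i + 2 * ΔAt i ≤ 2 * blueAt i
    impressionBound i = presenceBound (impressionLoad i) (intoSAt≤deg i) (ΔAt≤deg i)
                                      (coveredImpressionHasBlue D blue col i)

  weightSide : sumFin single + 2 * sumFin (nBlue f blue)
    ≤ 2 * cardABR f blue + 4 * cardABB f blue + 3 * cardAB f blue + cardAR f blue
  weightSide = begin
    sumFin single + 2 * sumFin nB              ≡⟨ sym (trans (sumFin-+ single (λ a → 2 * nB a))
                                                             (cong (sumFin single +_) (sumFin-* 2 nB))) ⟩
    sumFin (λ a → single a + 2 * nB a)         ≤⟨ sumFin-mono advertiserBound ⟩
    sumFin (λ a → classWeight (nB a) (nR a))   ≡⟨ sumClassWeight nB nR ⟩
    2 * cardABR f blue + 4 * cardABB f blue + 3 * cardAB f blue + cardAR f blue ∎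
    where
    nB nR : Fin na → ℕ
    nB = nBlue f blue
    nR = nRed f blue
    advertiserBound : ∀ a → single a + 2 * nB a ≤ classWeight (nB a) (nR a)
    advertiserBound a = subst (λ d → ind (d ≡ᵇ 1) + 2 * nB a ≤ classWeight (nB a) (nR a)) split
      (weightBound (nB a) (nR a) (subst (_≤ 2) (sym split) (proj₁ (proj₂ feasible) a)))
      where
      split : nB a + nR a ≡ degA f a
      split = count-split (f a) (blue a)


lemma4 : ∀ {na ni : ℕ} (E f : Fin na → Fin ni → Bool)
    → IsMaxFlow E f
    → (D : Decomposition f) (blue : Fin na → Fin ni → Bool)
    → IsColouring f D blue
    → (inS : Node na ni → Bool)
    → (∀ v → Reach E f v → inS v ≡ true)
    → (∀ v → inS v ≡ true → Reach E f v)
    → 3 * cardΔ E inS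
    ≤ 2 * cardABR f blue + 4 * cardABB f blue + 3 * cardAB f blue + cardAR f blue
lemma4 E f maxFlow D blue col inS sound complete = begin
  3 * cardΔ E inS                                         ≡⟨⟩
  cardΔ E inS + 2 * cardΔ E inS                           ≤⟨ +-monoˡ-≤ _ advertiserSide ⟩
  (sumFin single + sumFin intoSAt) + 2 * cardΔ E inS      ≡⟨ +-assoc (sumFin single) _ _ ⟩
  sumFin single + (sumFin intoSAt + 2 * cardΔ E inS)      ≤⟨ +-monoʳ-≤ (sumFin single) impressionSide ⟩
  sumFin single + 2 * sumFin (nBlue f blue)               ≤⟨ weightSide ⟩
  2 * cardABR f blue + 4 * cardABB f blue + 3 * cardAB f blue + cardAR f blue ∎
  where
  open DoubleCounting E f (proj₁ maxFlow) D blue col inS sound complete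
  open Cut E f (proj₁ maxFlow) inS sound complete using (intoSAt)
  open ≤-Reasoning
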